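{- For every $\pi\in S_n$, $$ptd(\pi)\geq\frac{n+1+c(\Gamma(\overline{\pi}))}{2}-c_1(\Gamma(\overline{\pi}))-\begin{cases}0 & \text{if } \pi_1=1,\\ 1 & \text{otherwise.}\end{cases}$$
   Context: Permutations are composed right to left; $\pi\in S_n$ is written $\langle \pi_1\ \cdots\ \pi_n\rangle$, $\pi_i=\pi(i)$, and identified with the permutation of $\{0,\ldots,n\}$ fixing $0$. $\overline{\pi}=(0,1,2,\ldots,n)\circ(0,\pi_n,\pi_{n-1},\ldots,\pi_1)$, a permutation of $\{0,\ldots,n\}$. For a permutation $\sigma$, $\Gamma(\sigma)$ is its functional digraph; $c(\Gamma(\sigma))$ is its number of cycles including fixed points and $c_1(\Gamma(\sigma))$ its number of fixed points. A prefix transposition is a permutation of the form $\langle j\ \cdots\ l-1\ \ 1\ \cdots\ j-1\ \ l\ \cdots\ n\rangle\in S_n$ with $1<j<l\leq n+1$ (it moves the initial segment $\pi_1\cdots\pi_{j-1}$ of $\pi$ to just before position $l$ when multiplied on the right). $ptd(\pi)$ is the minimum $t$ such that $\pi\circ s_1\circ\cdots\circ s_t=\iota$ for prefix transpositions $s_1,\ldots,s_t$, where $\iota$ is the identity. -}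

module Defs where

open import Data.Nat using (ℕ; zero; suc; _+_; _*_; _∸_; _≤_; _<_; _<?_; _≤?_)
open import Data.Fin using (Fin; toℕ; fromℕ<; _≟_)
import Data.Fin as Fin
open import Data.Fin.Permutation using (Permutation′; _⟨$⟩ʳ_)
open import Data.List using (List; []; _∷_; length; filter; allFin; upTo; map; reverse)
open import Data.List.Relation.Unary.All using (All; all?)
open import Data.Bool using (Bool; true; false; if_then_else_)
open import Relation.Nullary using (yes; no; does)
open import Relation.Binary.PropositionalEquality using (_≡_)
open import Function using (_∘_; id)

iter : ∀ {m} → (Fin m → Fin m) → ℕ → Fin m → Fin m
iter σ zero    x = x
iter σ (suc k) x = σ (iter σ k x)

-- Cyclic permutation (a₀, a₁, …, a_r) written as a list of (distinct) elements:
-- a_k ↦ a_{k+1}, a_r ↦ a₀, all other points fixed.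
private
  next : ∀ {m} → Fin m → List (Fin m) → Fin m → Fin m
  next f []            x = x
  next f (b ∷ [])      x = if does (x ≟ b) then f else x
  next f (b ∷ c ∷ rest) x = if does (x ≟ b) then c else next f (c ∷ rest) x

cycle : ∀ {m} → List (Fin m) → Fin m → Fin m
cycle []       x = x
cycle (a ∷ as) x = next a (a ∷ as) x

-- Number of cycles (fixed points included) of a permutation σ of Fin m:
-- the number of orbits, counted by their minimal elements
-- (x is the minimum of its orbit {σ^k x | k < m}).
OrbitMin : ∀ {m} → (Fin m → Fin m) → Fin m → Set
OrbitMin {m} σ x = All (λ k → toℕ x ≤ toℕ (iter σ k x)) (upTo m)

numCycles : ∀ {m} → (Fin m → Fin m) → ℕ
numCycles {m} σ = length (filter (λ x → all? (λ k → toℕ x ≤? toℕ (iter σ k x)) (upTo m)) (allFin m))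

numFixed : ∀ {m} → (Fin m → Fin m) → ℕ
numFixed {m} σ = length (filter (λ x → σ x ≟ x) (allFin m))

-- Elements of S_n: Permutation′ n on Fin n, where Fin.zero ↔ 1, …, the
-- element k ↔ k+1.  The associated permutation of {0,…,n} fixing 0 sends
-- 0 ↦ 0 and suc k ↦ suc (π k) (Fin (suc n), zero ↔ 0).

-- π̄ = (0,1,2,…,n) ∘ (0, π_n, π_{n-1}, …, π_1)  on {0,…,n} = Fin (suc n).
piBar : ∀ {n} → Permutation′ n → Fin (suc n) → Fin (suc n)
piBar {n} π =
  cycle (allFin (suc n))
  ∘ cycle (Fin.zero ∷ reverse (map (λ i → Fin.suc (π ⟨$⟩ʳ i)) (allFin n)))

-- Prefix transposition ⟨ j ⋯ l-1  1 ⋯ j-1  l ⋯ n ⟩ with 1 < j < l ≤ n+1.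
record PrefixTransposition (n : ℕ) : Set where
  constructor pt
  field
    j l  : ℕ
    1<j  : 1 < j
    j<l  : j < l
    l≤n+1 : l ≤ suc n

-- Build a Fin n from a natural number, with a fallback (never used for
-- valid prefix transpositions, since all values computed are < n).
private
  toFinOr : ∀ {n} → ℕ → Fin n → Fin n
  toFinOr {n} v d with v <? n
  ... | yes v<n = fromℕ< v<n
  ... | no  _   = d

-- The prefix transposition as a function on positions (0-indexed:
-- position p ∈ Fin n is the 1-indexed position i = p+1):
--   i ≤ l-j        ↦ j+i-1
--   l-j < i ≤ l-1  ↦ i-(l-j)
--   i ≥ l          ↦ i
ptFun : ∀ {n} → PrefixTransposition n → Fin n → Fin n
ptFun (pt j l _ _ _) p with suc (toℕ p) ≤? l ∸ j
... | yes _ = toFinOr (j ∸ 1 + toℕ p) p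
... | no  _ with suc (toℕ p) ≤? l ∸ 1
...   | yes _ = toFinOr (toℕ p ∸ (l ∸ j)) p
...   | no  _ = p

composeAll : ∀ {n} → (Fin n → Fin n) → List (PrefixTransposition n) → Fin n → Fin n
composeAll f []       = f
composeAll f (s ∷ ss) = composeAll (f ∘ ptFun s) ss

Sorts : ∀ {n} → Permutation′ n → List (PrefixTransposition n) → Set
Sorts {n} π ss = ∀ i → composeAll (π ⟨$⟩ʳ_) ss i ≡ i

delta : ∀ {n} → Permutation′ n → ℕ
delta {zero}  π = 0
delta {suc n} π = if does (π ⟨$⟩ʳ Fin.zero ≟ Fin.zero) then 0 else 1

-- Let ρ = (0 1 ⋯ n) and let π̂ extend π by 0 ↦ 0, so that π̄ = ρ π̂ ρ⁻¹ π̂⁻¹. A prefix transposition s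
-- with parameters j < l satisfies ρ ŝ ρ⁻¹ = (j 1 ρ(l−1)) ŝ, hence the π̄ of π ∘ s is π̄ ∘ (a b c) with
-- a = π̂ j, b = π₁ and c = π̂ (ρ (l−1)). Writing the 3-cycle as a product of two transpositions shows that
-- the number of cycles grows by at most two, and only through new fixed points at b and c; moreover
-- π̄ π₁ = 1, so π̄ fixes π₁ exactly when π₁ = 1. Accounting for these fixed points, the quantity
-- n + 1 + c(π̄) − 2 c₁(π̄) − 2 δ(π) decreases by at most 2 with each prefix transposition, and it
-- vanishes at the identity.

module Submission where

open import Defs
open import Data.Nat using (ℕ; suc; _+_; _*_; _≤_)
open import Data.List using (List; length)
open import Data.Fin.Permutation using (Permutation′)

open import Data.Bool using (if_then_else_)
import Data.Fin.Properties as Fin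
open import Data.Fin as Fin using (Fin; toℕ; _≟_)
open import Data.Fin.Properties using (toℕ-injective; pigeonhole; toℕ≤pred[n]; punchInᵢ≢i)
open import Data.Fin.Permutation using (_⟨$⟩ʳ_)
open import Data.Fin.Permutation.Components using (transpose; transpose-inverse)
open import Data.List using ([]; _∷_; _∷ʳ_; filter; allFin; upTo; tabulate; map; reverse)
open import Data.List.Properties using (map-tabulate; reverse-++; filter-all; length-tabulate)
open import Data.List.Membership.Propositional.Properties using (∈-allFin)
open import Data.List.Relation.Unary.All as All using (All; []; _∷_)
open import Data.List.Relation.Unary.All.Properties using (applyUpTo⁺₁; applyUpTo⁻; ¬All⇒Any¬)
open import Data.List.Relation.Unary.Any as Any using (Any; here; there)
import Data.List.Relation.Unary.Any.Properties as AnyP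
open import Data.List.Relation.Unary.Unique.Propositional using (Unique; []; _∷_)
open import Data.List.Relation.Unary.Unique.Propositional.Properties using (allFin⁺)
import Data.Nat as ℕ
open import Data.Nat using (zero; _∸_; _<_; z≤n; s≤s; z<s; _≤?_; _<?_)
open import Data.Nat.DivMod using (_%_; _/_; m≡m%n+[m/n]*n; m%n<n)
open import Data.Nat.Properties hiding (_≟_)
open import Algebra.Properties.CommutativeMonoid.Sum +-0-commutativeMonoid using (sum; sum-remove; sum-cong-≗)
open import Data.Nat.Tactic.RingSolver using (solve-∀)
open import Data.Product as Product using (∃; _×_; _,_)
open import Data.Sum as Sum using (_⊎_; inj₁; inj₂; [_,_])
open import Data.Vec.Functional using (Vector; removeAt; updateAt)
open import Data.Vec.Functional.Properties using (updateAt-updates; updateAt-minimal)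
open import Function using (_∘_; id; const)
open import Function.Definitions using (Injective)
open import Relation.Binary using (tri<; tri≈; tri>)
open import Relation.Binary.PropositionalEquality
  using (_≡_; _≢_; refl; sym; trans; cong; cong₂; subst; subst₂; module ≡-Reasoning)
open import Relation.Nullary using (¬_; Dec; yes; no; does; contradiction)
open import Relation.Unary using (Decidable)

-- Orbits

iter-+ : ∀ {m} (σ : Fin m → Fin m) a b x → iter σ (a + b) x ≡ iter σ a (iter σ b x)
iter-+ σ zero    b x = refl
iter-+ σ (suc a) b x = cong σ (iter-+ σ a b x)

iter-injective : ∀ {m} {σ : Fin m → Fin m} → Injective _≡_ _≡_ σ → ∀ k → Injective _≡_ _≡_ (iter σ k)
iter-injective inj zero    e = e
iter-injective inj (suc k) e = iter-injective inj k (inj e)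

iter-cong : ∀ {m} {σ τ : Fin m → Fin m} → (∀ x → σ x ≡ τ x) → ∀ k x → iter σ k x ≡ iter τ k x
iter-cong e zero    x = refl
iter-cong {σ = σ} e (suc k) x = trans (cong σ (iter-cong e k x)) (e _)

iter-fixed : ∀ {m} {σ : Fin m → Fin m} {y} → σ y ≡ y → ∀ k → iter σ k y ≡ y
iter-fixed e zero    = refl
iter-fixed {σ = σ} e (suc k) = trans (cong σ (iter-fixed e k)) e

iter-*-period : ∀ {m} (σ : Fin m → Fin m) p {x} → iter σ p x ≡ x → ∀ q → iter σ (q * p) x ≡ x
iter-*-period σ p e zero    = refl
iter-*-period σ p {x} e (suc q) =
  trans (iter-+ σ p (q * p) x) (trans (cong (iter σ p) (iter-*-period σ p e q)) e)

iter-period : ∀ {m} {σ : Fin m → Fin m} → Injective _≡_ _≡_ σ → ∀ x → ∃ λ p → p < m × iter σ (suc p) x ≡ x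
iter-period {m} {σ} inj x
  with i , j , i<j , σⁱx≡σʲx ← pigeonhole (n<1+n m) (λ (i : Fin (suc m)) → iter σ (toℕ i) x)
  with p , i+1+p≡j ← m≤n⇒∃[o]m+o≡n i<j
  = p , p<m , iter-injective inj (toℕ i) (begin
      iter σ (toℕ i) (iter σ (suc p) x) ≡⟨ iter-+ σ (toℕ i) (suc p) x ⟨
      iter σ (toℕ i + suc p) x          ≡⟨ cong (λ t → iter σ t x) i+suc-p≡j ⟩
      iter σ (toℕ j) x                  ≡⟨ σⁱx≡σʲx ⟨
      iter σ (toℕ i) x                  ∎)
  where
  open ≡-Reasoning
  i+suc-p≡j : toℕ i + suc p ≡ toℕ j
  i+suc-p≡j = trans (+-suc (toℕ i) p) i+1+p≡j
  p<m : p < m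
  p<m = ≤-trans (s≤s (m≤n+m p (toℕ i))) (≤-trans (≤-reflexive i+1+p≡j) (toℕ≤pred[n] j))

iter-below : ∀ {m} {σ : Fin m → Fin m} → Injective _≡_ _≡_ σ → ∀ x k → ∃ λ k′ → k′ < m × iter σ k x ≡ iter σ k′ x
iter-below {σ = σ} inj x k with p , p<m , e ← iter-period inj x =
  k % suc p , <-≤-trans (m%n<n k (suc p)) p<m ,
  trans (cong (λ t → iter σ t x) (m≡m%n+[m/n]*n k (suc p)))
        (trans (iter-+ σ (k % suc p) (k / suc p * suc p) x)
               (cong (iter σ (k % suc p)) (iter-*-period σ (suc p) e (k / suc p))))

Reach : ∀ {m} → (Fin m → Fin m) → Fin m → Fin m → Set
Reach σ x y = ∃ λ k → iter σ k x ≡ y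

reach-refl : ∀ {m} {σ : Fin m → Fin m} {x} → Reach σ x x
reach-refl = 0 , refl

reach-step : ∀ {m} {σ : Fin m → Fin m} {x y} → Reach σ x y → Reach σ x (σ y)
reach-step (k , e) = suc k , cong _ e

reach-trans : ∀ {m} {σ : Fin m → Fin m} {x y z} → Reach σ x y → Reach σ y z → Reach σ x z
reach-trans {σ = σ} {x} (k , refl) (k′ , refl) = k′ + k , iter-+ σ k′ k x

reach-sym : ∀ {m} {σ : Fin m → Fin m} → Injective _≡_ _≡_ σ → ∀ {x y} → Reach σ x y → Reach σ y x
reach-sym {σ = σ} inj {x} (k , refl) with p , _ , e ← iter-period inj x =
  k * suc p ∸ k ,
  trans (sym (iter-+ σ (k * suc p ∸ k) k x))
        (trans (cong (λ t → iter σ t x) (m∸n+n≡m (m≤m*n k (suc p)))) (iter-*-period σ (suc p) e k))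

reach-≗ : ∀ {m} {σ τ : Fin m → Fin m} → (∀ w → Reach σ w (τ w)) → ∀ {u v} → Reach τ u v → Reach σ u v
reach-≗ h (zero  , refl) = reach-refl
reach-≗ {τ = τ} h {u} (suc k , refl) = reach-trans (reach-≗ h (k , refl)) (h (iter τ k u))

IsOrbitMin : ∀ {m} → (Fin m → Fin m) → Fin m → Set
IsOrbitMin σ x = ∀ y → Reach σ x y → toℕ x ≤ toℕ y

orbitMin? : ∀ {m} (σ : Fin m → Fin m) → Decidable (OrbitMin σ)
orbitMin? {m} σ x = All.all? (λ k → toℕ x ≤? toℕ (iter σ k x)) (upTo m)

orbitMin⇒isOrbitMin : ∀ {m} {σ : Fin m → Fin m} → Injective _≡_ _≡_ σ → ∀ {x} → OrbitMin σ x → IsOrbitMin σ x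
orbitMin⇒isOrbitMin {m} {σ} inj {x} om y (k , refl) with k′ , k′<m , e ← iter-below inj x k =
  subst (λ t → toℕ x ≤ toℕ t) (sym e) (applyUpTo⁻ id m om k′<m)

isOrbitMin⇒orbitMin : ∀ {m} {σ : Fin m → Fin m} {x} → IsOrbitMin σ x → OrbitMin σ x
isOrbitMin⇒orbitMin {m} mn = applyUpTo⁺₁ id m (λ {k} _ → mn _ (k , refl))

orbitMin-unique : ∀ {m} {σ : Fin m → Fin m} → Injective _≡_ _≡_ σ → ∀ {u w} →
                  IsOrbitMin σ u → IsOrbitMin σ w → Reach σ u w → u ≡ w
orbitMin-unique inj mu mw r = toℕ-injective (≤-antisym (mu _ r) (mw _ (reach-sym inj r)))

OrbitMinOf : ∀ {m} → (Fin m → Fin m) → Fin m → Fin m → Set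
OrbitMinOf σ x w = Reach σ x w × IsOrbitMin σ w

orbitMin-exists : ∀ {m} {σ : Fin m → Fin m} → Injective _≡_ _≡_ σ → ∀ x → ∃ (OrbitMinOf σ x)
orbitMin-exists {m} {σ} inj x = descend (suc (toℕ x)) x ≤-refl
  where
  descend : ∀ b x → toℕ x < b → ∃ (OrbitMinOf σ x)
  descend (suc b) x x<b with orbitMin? σ x
  ... | yes om = x , reach-refl , orbitMin⇒isOrbitMin inj om
  ... | no ¬om
    with k , _ , x≰σᵏx ← AnyP.applyUpTo⁻ id (¬All⇒Any¬ (λ k → toℕ x ≤? toℕ (iter σ k x)) (upTo m) ¬om)
    with w , r , mw ← descend b (iter σ k x) (<-≤-trans (≰⇒> x≰σᵏx) (≤-pred x<b))
    = w , reach-trans (k , refl) r , mw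

module _ {A : Set} {P Q : A → Set} (P? : Decidable P) (Q? : Decidable Q) where

  length-filter-mono : ∀ {xs} → All (λ x → P x → Q x) xs →
                       length (filter P? xs) ≤ length (filter Q? xs)
  length-filter-mono [] = z≤n
  length-filter-mono {x ∷ _} (h ∷ hs) with P? x | Q? x
  ... | yes _ | yes _ = s≤s (length-filter-mono hs)
  ... | yes p | no ¬q = contradiction (h p) ¬q
  ... | no _  | yes _ = m≤n⇒m≤1+n (length-filter-mono hs)
  ... | no _  | no _  = length-filter-mono hs

  length-filter-mono-< : ∀ {xs} → All (λ x → P x → Q x) xs → Any (λ x → Q x × ¬ P x) xs →
                         length (filter P? xs) < length (filter Q? xs)
  length-filter-mono-< {x ∷ _} (h ∷ hs) (here (q , ¬p)) with P? x | Q? x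
  ... | yes p | _     = contradiction p ¬p
  ... | no _  | no ¬q = contradiction q ¬q
  ... | no _  | yes _ = s≤s (length-filter-mono hs)
  length-filter-mono-< {x ∷ _} (h ∷ hs) (there a) with P? x | Q? x
  ... | yes _ | yes _ = s≤s (length-filter-mono-< hs a)
  ... | yes p | no ¬q = contradiction (h p) ¬q
  ... | no _  | yes _ = m≤n⇒m≤1+n (length-filter-mono-< hs a)
  ... | no _  | no _  = length-filter-mono-< hs a

module _ {m} {P Q : Fin m → Set} (P? : Decidable P) (Q? : Decidable Q) (z : Fin m) where

  length-filter-mono-except : (∀ x → P x → Q x ⊎ x ≡ z) → ∀ {xs} → Unique xs →
                              length (filter P? xs) ≤ suc (length (filter Q? xs))
  length-filter-mono-except h [] = z≤n
  length-filter-mono-except h {x ∷ xs} (x∉xs ∷ u) with x ≟ z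
  ... | no x≢z with P? x | Q? x
  ...   | yes _ | yes _ = s≤s (length-filter-mono-except h u)
  ...   | yes p | no ¬q = contradiction ([ id , (λ x≡z → contradiction x≡z x≢z) ] (h x p)) ¬q
  ...   | no _  | yes _ = m≤n⇒m≤1+n (length-filter-mono-except h u)
  ...   | no _  | no _  = length-filter-mono-except h u
  length-filter-mono-except h {x ∷ xs} (x∉xs ∷ u) | yes refl
    with rest ← length-filter-mono P? Q? {xs}
                  (All.map (λ x≢y p → [ id , (λ y≡x → contradiction (sym y≡x) x≢y) ] (h _ p)) x∉xs)
    with P? x | Q? x
  ... | yes _ | yes _ = s≤s (m≤n⇒m≤1+n rest)
  ... | yes _ | no _  = s≤s rest
  ... | no _  | yes _ = m≤n⇒m≤1+n (m≤n⇒m≤1+n rest)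
  ... | no _  | no _  = m≤n⇒m≤1+n rest

-- Cycle counts

orbitMin-transfer : ∀ {m} {σ τ : Fin m → Fin m} → Injective _≡_ _≡_ σ → (∀ w → Reach σ w (τ w)) →
                    ∀ x → OrbitMin σ x → OrbitMin τ x
orbitMin-transfer inj h x om = isOrbitMin⇒orbitMin (λ y r → orbitMin⇒isOrbitMin inj om y (reach-≗ h r))

numCycles-mono-< : ∀ {m} {σ τ : Fin m → Fin m} → Injective _≡_ _≡_ σ → (∀ w → Reach σ w (τ w)) →
                   ∀ z → IsOrbitMin τ z → ¬ IsOrbitMin σ z → numCycles σ < numCycles τ
numCycles-mono-< {σ = σ} {τ} inj h z mτ ¬mσ = length-filter-mono-< (orbitMin? σ) (orbitMin? τ) {allFin _}
  (All.universal (orbitMin-transfer inj h) _)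
  (Any.map (λ { refl → isOrbitMin⇒orbitMin mτ , ¬mσ ∘ orbitMin⇒isOrbitMin inj }) (∈-allFin z))

orbitMin-cong : ∀ {m} {σ τ : Fin m → Fin m} → (∀ w → σ w ≡ τ w) → ∀ x → OrbitMin σ x → OrbitMin τ x
orbitMin-cong e x = All.map (λ {k} → subst (λ y → toℕ x ≤ toℕ y) (iter-cong e k x))

numCycles-cong : ∀ {m} {σ τ : Fin m → Fin m} → (∀ w → σ w ≡ τ w) → numCycles σ ≡ numCycles τ
numCycles-cong {σ = σ} {τ} e = ≤-antisym
  (length-filter-mono (orbitMin? σ) (orbitMin? τ) {allFin _} (All.universal (orbitMin-cong e) _))
  (length-filter-mono (orbitMin? τ) (orbitMin? σ) {allFin _} (All.universal (orbitMin-cong (sym ∘ e)) _))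

transpose-ˡ : ∀ {m} (i j : Fin m) → transpose i j i ≡ j
transpose-ˡ i j with i ≟ i
... | yes _   = refl
... | no i≢i = contradiction refl i≢i

transpose-ʳ : ∀ {m} (i j : Fin m) → transpose i j j ≡ i
transpose-ʳ i j with j ≟ i
... | yes j≡i = j≡i
... | no _ with j ≟ j
...   | yes _   = refl
...   | no j≢j = contradiction refl j≢j

transpose-≢ : ∀ {m} (i j : Fin m) {k} → k ≢ i → k ≢ j → transpose i j k ≡ k
transpose-≢ i j {k} k≢i k≢j with k ≟ i
... | yes k≡i = contradiction k≡i k≢i
... | no _ with k ≟ j
...   | yes k≡j = contradiction k≡j k≢j
...   | no _    = refl

transpose-injective : ∀ {m} (i j : Fin m) → Injective _≡_ _≡_ (transpose i j)
transpose-injective i j {x} {y} e =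
  trans (sym (transpose-inverse j i)) (trans (cong (transpose j i) e) (transpose-inverse j i))

transpose-conj : ∀ {m} {h : Fin m → Fin m} → Injective _≡_ _≡_ h →
                 ∀ i j k → transpose (h i) (h j) (h k) ≡ h (transpose i j k)
transpose-conj {h = h} inj i j k with k ≟ i
... | yes refl = transpose-ˡ (h k) (h j)
... | no k≢i with k ≟ j
...   | yes refl = transpose-ʳ (h i) (h k)
...   | no k≢j = transpose-≢ (h i) (h j) (k≢i ∘ inj) (k≢j ∘ inj)

-- Multiplying by (x y) with σ x = y makes y a fixed point, splitting it off its cycle.
numCycles-∘transpose-split : ∀ {m} {σ : Fin m → Fin m} → Injective _≡_ _≡_ σ → ∀ {x y} → σ x ≡ y → x ≢ y →
                             numCycles σ < numCycles (σ ∘ transpose x y)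
numCycles-∘transpose-split {σ = σ} inj {x} {y} σx≡y x≢y =
  let z , mτ , ¬mσ = new-min in numCycles-mono-< inj steps z mτ ¬mσ
  where
  τ = σ ∘ transpose x y
  τ-injective : Injective _≡_ _≡_ τ
  τ-injective = transpose-injective x y ∘ inj
  τy≡y : τ y ≡ y
  τy≡y = trans (cong σ (transpose-ʳ x y)) σx≡y
  steps : ∀ w → Reach σ w (τ w)
  steps w with w ≟ x
  ... | yes refl = 2 , cong σ σx≡y
  ... | no _ with w ≟ y
  ...   | yes refl = 0 , sym σx≡y
  ...   | no _     = 1 , refl
  new-min : ∃ λ z → IsOrbitMin τ z × ¬ IsOrbitMin σ z
  new-min with orbitMin? σ y
  ... | no ¬om = y , (λ { _ (k , refl) → ≤-reflexive (cong toℕ (sym (iter-fixed τy≡y k))) }) , ¬om ∘ isOrbitMin⇒orbitMin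
  ... | yes om with w , (k , refl) , mw ← orbitMin-exists τ-injective x = w , mw , ¬mσw
    where
    w≢y : iter τ k x ≢ y
    w≢y e = x≢y (iter-injective τ-injective k (trans e (sym (iter-fixed τy≡y k))))
    ¬mσw : ¬ IsOrbitMin σ (iter τ k x)
    ¬mσw mσw = w≢y (sym (orbitMin-unique inj (orbitMin⇒isOrbitMin inj om) mσw
                     (reach-trans (reach-sym inj (1 , σx≡y)) (reach-≗ steps (k , refl)))))

reach-∘transpose : ∀ {m} (σ : Fin m → Fin m) x y {u v} → Reach (σ ∘ transpose x y) u v →
  Reach σ u v ⊎ ((Reach σ u x ⊎ Reach σ u y) × (Reach σ x v ⊎ Reach σ y v))
reach-∘transpose σ x y (zero , refl) = inj₁ reach-refl
reach-∘transpose σ x y {u} (suc k , refl) = step (reach-∘transpose σ x y (k , refl))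
  where
  step : ∀ {v} → Reach σ u v ⊎ ((Reach σ u x ⊎ Reach σ u y) × (Reach σ x v ⊎ Reach σ y v)) →
         Reach σ u (σ (transpose x y v)) ⊎
           ((Reach σ u x ⊎ Reach σ u y) × (Reach σ x (σ (transpose x y v)) ⊎ Reach σ y (σ (transpose x y v))))
  step {v} h with v ≟ x
  step (inj₁ r)       | yes refl = inj₂ (inj₁ r , inj₂ (1 , refl))
  step (inj₂ (r , _)) | yes refl = inj₂ (r , inj₂ (1 , refl))
  step {v} h          | no _ with v ≟ y
  step (inj₁ r)       | no _ | yes refl = inj₂ (inj₂ r , inj₁ (1 , refl))
  step (inj₂ (r , _)) | no _ | yes refl = inj₂ (r , inj₁ (1 , refl))
  step (inj₁ r)                | no _ | no _ = inj₁ (reach-step r)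
  step (inj₂ (r , inj₁ r′))    | no _ | no _ = inj₂ (r , inj₁ (reach-step r′))
  step (inj₂ (r , inj₂ r′))    | no _ | no _ = inj₂ (r , inj₂ (reach-step r′))

orbitMin-survives : ∀ {m} {σ τ : Fin m → Fin m} → Injective _≡_ _≡_ σ → ∀ {p q mp mq} →
  OrbitMinOf σ p mp → OrbitMinOf σ q mq → toℕ mp ≤ toℕ mq →
  (∀ {u v} → Reach τ u v → Reach σ u v ⊎ ((Reach σ u p ⊎ Reach σ u q) × (Reach σ p v ⊎ Reach σ q v))) →
  ∀ u → OrbitMin σ u → OrbitMin τ u ⊎ u ≡ mq
orbitMin-survives {σ = σ} {τ} inj {p} {q} {mp} {mq} (p⇝mp , min-mp) (q⇝mq , min-mq) mp≤mq decompose u om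
  with u ≟ mq
... | yes u≡mq = inj₂ u≡mq
... | no u≢mq = inj₁ (isOrbitMin⇒orbitMin u-min)
  where
  min-u = orbitMin⇒isOrbitMin inj om
  u≡mp : Reach σ u p ⊎ Reach σ u q → u ≡ mp
  u≡mp (inj₁ u⇝p) = orbitMin-unique inj min-u min-mp (reach-trans u⇝p p⇝mp)
  u≡mp (inj₂ u⇝q) = contradiction (orbitMin-unique inj min-u min-mq (reach-trans u⇝q q⇝mq)) u≢mq
  mp≤ : ∀ {v} → Reach σ p v ⊎ Reach σ q v → toℕ mp ≤ toℕ v
  mp≤ (inj₁ p⇝v) = min-mp _ (reach-trans (reach-sym inj p⇝mp) p⇝v)
  mp≤ (inj₂ q⇝v) = ≤-trans mp≤mq (min-mq _ (reach-trans (reach-sym inj q⇝mq) q⇝v))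
  u-min : IsOrbitMin τ u
  u-min v r with decompose r
  ... | inj₁ r′ = min-u v r′
  ... | inj₂ (u⇝ , ⇝v) = subst (λ w → toℕ w ≤ toℕ v) (sym (u≡mp u⇝)) (mp≤ ⇝v)

numCycles-∘transpose-≥ : ∀ {m} {σ : Fin m → Fin m} → Injective _≡_ _≡_ σ → ∀ x y →
                         numCycles σ ≤ suc (numCycles (σ ∘ transpose x y))
numCycles-∘transpose-≥ {σ = σ} inj x y
  with mx , minx ← orbitMin-exists inj x | my , miny ← orbitMin-exists inj y | toℕ mx ≤? toℕ my
... | yes mx≤my = length-filter-mono-except (orbitMin? σ) (orbitMin? _) my
      (orbitMin-survives inj minx miny mx≤my (reach-∘transpose σ x y)) (allFin⁺ _)
... | no mx≰my = length-filter-mono-except (orbitMin? σ) (orbitMin? _) mx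
      (orbitMin-survives inj miny minx (<⇒≤ (≰⇒> mx≰my)) (Sum.map₂ (Product.map Sum.swap Sum.swap) ∘ reach-∘transpose σ x y))
      (allFin⁺ _)

cycle₃ : ∀ {m} → Fin m → Fin m → Fin m → Fin m → Fin m
cycle₃ a b c = transpose a c ∘ transpose a b

module _ {m} {a b c : Fin m} (a≢b : a ≢ b) (a≢c : a ≢ c) (b≢c : b ≢ c) where

  cycle₃-a : cycle₃ a b c a ≡ b
  cycle₃-a = trans (cong (transpose a c) (transpose-ˡ a b)) (transpose-≢ a c (a≢b ∘ sym) b≢c)

  cycle₃-b : cycle₃ a b c b ≡ c
  cycle₃-b = trans (cong (transpose a c) (transpose-ʳ a b)) (transpose-ˡ a c)

  cycle₃-c : cycle₃ a b c c ≡ a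
  cycle₃-c = trans (cong (transpose a c) (transpose-≢ a b (a≢c ∘ sym) (b≢c ∘ sym))) (transpose-ʳ a c)

  cycle₃-≢ : ∀ {w} → w ≢ a → w ≢ b → w ≢ c → cycle₃ a b c w ≡ w
  cycle₃-≢ w≢a w≢b w≢c = trans (cong (transpose a c) (transpose-≢ a b w≢a w≢b)) (transpose-≢ a c w≢a w≢c)

by-cases₃ : ∀ {m} {a b c : Fin m} (P : Fin m → Set) → P a → P b → P c →
            (∀ {w} → w ≢ a → w ≢ b → w ≢ c → P w) → ∀ w → P w
by-cases₃ {a = a} {b} {c} P pa pb pc po w with w ≟ a | w ≟ b | w ≟ c
... | yes refl | _        | _        = pa
... | no _     | yes refl | _        = pb
... | no _     | no _     | yes refl = pc
... | no w≢a   | no w≢b   | no w≢c   = po w≢a w≢b w≢c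

cycle₃-rotate : ∀ {m} {a b c : Fin m} → a ≢ b → a ≢ c → b ≢ c → ∀ w → cycle₃ a b c w ≡ cycle₃ c a b w
cycle₃-rotate {a = a} {b} {c} a≢b a≢c b≢c = by-cases₃ (λ w → cycle₃ a b c w ≡ cycle₃ c a b w)
  (trans (cycle₃-a a≢b a≢c b≢c) (sym (cycle₃-b c≢a c≢b a≢b)))
  (trans (cycle₃-b a≢b a≢c b≢c) (sym (cycle₃-c c≢a c≢b a≢b)))
  (trans (cycle₃-c a≢b a≢c b≢c) (sym (cycle₃-a c≢a c≢b a≢b)))
  (λ w≢a w≢b w≢c → trans (cycle₃-≢ a≢b a≢c b≢c w≢a w≢b w≢c) (sym (cycle₃-≢ c≢a c≢b a≢b w≢c w≢a w≢b)))
  where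
  c≢a = a≢c ∘ sym
  c≢b = b≢c ∘ sym

cycle₃-conj : ∀ {m} {h : Fin m → Fin m} → Injective _≡_ _≡_ h →
              ∀ a b c w → cycle₃ (h a) (h b) (h c) (h w) ≡ h (cycle₃ a b c w)
cycle₃-conj {h = h} inj a b c w =
  trans (cong (transpose (h a) (h c)) (transpose-conj inj a b w)) (transpose-conj inj a c (transpose a b w))

indicator : ∀ {P : Set} → Dec P → ℕ
indicator (yes _) = 1
indicator (no _)  = 0

indicator-yes : ∀ {P : Set} (d : Dec P) → P → indicator d ≡ 1
indicator-yes (yes _) _ = refl
indicator-yes (no ¬p) p = contradiction p ¬p

indicator-no : ∀ {P : Set} (d : Dec P) → ¬ P → indicator d ≡ 0
indicator-no (yes p) ¬p = contradiction p ¬p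
indicator-no (no _)  _  = refl

fixedAt : ∀ {m} → (Fin m → Fin m) → Fin m → ℕ
fixedAt σ w = indicator (σ w ≟ w)

-- Write the 3-cycle as a product of two transpositions in the two ways that start by
-- splitting off a new fixed point b or c.
numCycles-∘cycle₃ : ∀ {m} {σ σ′ : Fin m → Fin m} → Injective _≡_ _≡_ σ → ∀ {a b c} → a ≢ b → a ≢ c → b ≢ c →
                    (∀ w → σ′ w ≡ σ (cycle₃ a b c w)) →
                    numCycles σ + 2 * (fixedAt σ′ b + fixedAt σ′ c) ≤ numCycles σ′ + 2
numCycles-∘cycle₃ {σ = σ} {σ′} inj {a} {b} {c} a≢b a≢c b≢c σ′≗ =
  subst (λ t → numCycles σ + 2 * t ≤ numCycles σ′ + 2)
        (sym (cong₂ _+_ (cong (λ v → indicator (v ≟ b)) (trans (σ′≗ b) (cong σ (cycle₃-b a≢b a≢c b≢c))))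
                        (cong (λ v → indicator (v ≟ c)) (trans (σ′≗ c) (cong σ (cycle₃-c a≢b a≢c b≢c))))))
        cases
  where
  σ′≡ᵃ : numCycles ((σ ∘ transpose a c) ∘ transpose a b) ≡ numCycles σ′
  σ′≡ᵃ = numCycles-cong (sym ∘ σ′≗)
  σ′≡ᶜ : numCycles ((σ ∘ transpose c b) ∘ transpose c a) ≡ numCycles σ′
  σ′≡ᶜ = numCycles-cong (λ w → sym (trans (σ′≗ w) (cong σ (cycle₃-rotate a≢b a≢c b≢c w))))
  merge-ac : numCycles (σ ∘ transpose a c) ≤ suc (numCycles σ′)
  merge-ac = subst (λ t → _ ≤ suc t) σ′≡ᵃ (numCycles-∘transpose-≥ (transpose-injective a c ∘ inj) a b)
  merge-cb : numCycles (σ ∘ transpose c b) ≤ suc (numCycles σ′)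
  merge-cb = subst (λ t → _ ≤ suc t) σ′≡ᶜ (numCycles-∘transpose-≥ (transpose-injective c b ∘ inj) c a)
  cases : numCycles σ + 2 * (indicator (σ c ≟ b) + indicator (σ a ≟ c)) ≤ numCycles σ′ + 2
  cases with σ c ≟ b | σ a ≟ c
  ... | yes σc≡b | yes σa≡c = begin
    numCycles σ + 4                              ≡⟨ +-comm (numCycles σ) 4 ⟩
    3 + suc (numCycles σ)                        ≤⟨ +-monoʳ-≤ 3 (numCycles-∘transpose-split inj σa≡c a≢c) ⟩
    2 + suc (numCycles (σ ∘ transpose a c))      ≤⟨ +-monoʳ-≤ 2 (numCycles-∘transpose-split (transpose-injective a c ∘ inj)
                                                       (trans (cong σ (transpose-ˡ a c)) σc≡b) a≢b) ⟩
    2 + numCycles ((σ ∘ transpose a c) ∘ transpose a b) ≡⟨ cong (2 +_) σ′≡ᵃ ⟩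
    2 + numCycles σ′                             ≡⟨ +-comm 2 (numCycles σ′) ⟩
    numCycles σ′ + 2                             ∎
    where open ≤-Reasoning
  ... | yes σc≡b | no _ = +-monoˡ-≤ 2 (≤-pred (≤-trans (numCycles-∘transpose-split inj σc≡b (b≢c ∘ sym)) merge-cb))
  ... | no _ | yes σa≡c = +-monoˡ-≤ 2 (≤-pred (≤-trans (numCycles-∘transpose-split inj σa≡c a≢c) merge-ac))
  ... | no _ | no _ = begin
    numCycles σ + 0                  ≡⟨ +-identityʳ _ ⟩
    numCycles σ                      ≤⟨ numCycles-∘transpose-≥ inj a c ⟩
    suc (numCycles (σ ∘ transpose a c)) ≤⟨ s≤s merge-ac ⟩
    suc (suc (numCycles σ′))         ≡⟨ +-comm 2 (numCycles σ′) ⟩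
    numCycles σ′ + 2                 ∎
    where open ≤-Reasoning

-- Fixed points

numFixed≡sum : ∀ {m} (σ : Fin m → Fin m) → numFixed σ ≡ sum (fixedAt σ)
numFixed≡sum {m} σ = go id
  where
  go : ∀ {k} (f : Fin k → Fin m) → length (filter (λ x → σ x ≟ x) (tabulate f)) ≡ sum (fixedAt σ ∘ f)
  go {zero}  f = refl
  go {suc k} f with σ (f Fin.zero) ≟ f Fin.zero
  ... | yes _ = cong suc (go (f ∘ Fin.suc))
  ... | no _  = go (f ∘ Fin.suc)

sum-≗-except : ∀ {k} {h h′ : Vector ℕ k} z → (∀ w → w ≢ z → h w ≡ h′ w) → sum h + h′ z ≡ sum h′ + h z
sum-≗-except {suc k} {h} {h′} z h≗h′ = begin
  sum h + h′ z                        ≡⟨ cong (_+ h′ z) (sum-remove {i = z} h) ⟩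
  h z + sum (removeAt h z) + h′ z     ≡⟨ cong (λ t → h z + t + h′ z) (sum-cong-≗ (λ j → h≗h′ _ (punchInᵢ≢i z j))) ⟩
  h z + sum (removeAt h′ z) + h′ z    ≡⟨ swap-ends (h z) _ (h′ z) ⟩
  h′ z + sum (removeAt h′ z) + h z    ≡⟨ cong (_+ h z) (sum-remove {i = z} h′) ⟨
  sum h′ + h z                        ∎
  where
  open ≡-Reasoning
  swap-ends : ∀ x y z → x + y + z ≡ z + y + x
  swap-ends = solve-∀

telescope₃ : ∀ X X₁ X₂ X′ A B C A′ B′ C′ → X + A′ ≡ X₁ + A → X₁ + B′ ≡ X₂ + B → X₂ + C′ ≡ X′ + C →
             X′ + (A + B + C) ≡ X + (A′ + B′ + C′)
telescope₃ X X₁ X₂ X′ A B C A′ B′ C′ e₁ e₂ e₃ = +-cancelʳ-≡ (X₁ + X₂) _ _ (begin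
  X′ + (A + B + C) + (X₁ + X₂)         ≡⟨ regroup₁ X′ A B C X₁ X₂ ⟩
  (X₁ + A) + (X₂ + B) + (X′ + C)       ≡⟨ cong₂ (λ s t → s + t + (X′ + C)) e₁ e₂ ⟨
  (X + A′) + (X₁ + B′) + (X′ + C)      ≡⟨ cong ((X + A′) + (X₁ + B′) +_) e₃ ⟨
  (X + A′) + (X₁ + B′) + (X₂ + C′)     ≡⟨ regroup₂ X A′ X₁ B′ X₂ C′ ⟩
  X + (A′ + B′ + C′) + (X₁ + X₂)       ∎)
  where
  open ≡-Reasoning
  regroup₁ : ∀ x a b c x₁ x₂ → x + (a + b + c) + (x₁ + x₂) ≡ (x₁ + a) + (x₂ + b) + (x + c)
  regroup₁ = solve-∀
  regroup₂ : ∀ x a x₁ b x₂ c → (x + a) + (x₁ + b) + (x₂ + c) ≡ x + (a + b + c) + (x₁ + x₂)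
  regroup₂ = solve-∀

sum-≗-except₃ : ∀ {k} {h h′ : Vector ℕ k} {a b c} → a ≢ b → a ≢ c → b ≢ c →
                (∀ w → w ≢ a → w ≢ b → w ≢ c → h w ≡ h′ w) →
                sum h′ + (h a + h b + h c) ≡ sum h + (h′ a + h′ b + h′ c)
sum-≗-except₃ {h = h} {h′} {a} {b} {c} a≢b a≢c b≢c h≗h′ =
  telescope₃ (sum h) (sum h₁) (sum h₂) (sum h′) (h a) (h b) (h c) (h′ a) (h′ b) (h′ c)
    (trans (cong (sum h +_) (sym (updateAt-updates a h)))
           (sum-≗-except a (λ w w≢a → sym (updateAt-minimal w a h w≢a))))
    (trans (cong (sum h₁ +_) (sym (updateAt-updates b h₁)))
           (trans (sum-≗-except b (λ w w≢b → sym (updateAt-minimal w b h₁ w≢b)))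
                  (cong (sum h₂ +_) (updateAt-minimal b a h (a≢b ∘ sym)))))
    (trans (sum-≗-except c h₂≗h′)
           (cong (sum h′ +_) (trans (updateAt-minimal c b h₁ (b≢c ∘ sym)) (updateAt-minimal c a h (a≢c ∘ sym)))))
  where
  h₁ = updateAt h a (const (h′ a))
  h₂ = updateAt h₁ b (const (h′ b))
  h₂≗h′ : ∀ w → w ≢ c → h₂ w ≡ h′ w
  h₂≗h′ = by-cases₃ {a = a} {b} {c} (λ w → w ≢ c → h₂ w ≡ h′ w)
    (λ _ → trans (updateAt-minimal a b h₁ a≢b) (updateAt-updates a h))
    (λ _ → updateAt-updates b h₁)
    (λ c≢c → contradiction refl c≢c)
    (λ w≢a w≢b w≢c _ → trans (updateAt-minimal _ b h₁ w≢b) (trans (updateAt-minimal _ a h w≢a) (h≗h′ _ w≢a w≢b w≢c)))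

numFixed-except₃ : ∀ {m} {σ σ′ : Fin m → Fin m} {a b c} → a ≢ b → a ≢ c → b ≢ c →
                   (∀ w → w ≢ a → w ≢ b → w ≢ c → σ w ≡ σ′ w) →
                   numFixed σ′ + (fixedAt σ a + fixedAt σ b + fixedAt σ c)
                     ≡ numFixed σ + (fixedAt σ′ a + fixedAt σ′ b + fixedAt σ′ c)
numFixed-except₃ {σ = σ} {σ′} {a} {b} {c} a≢b a≢c b≢c σ≗σ′ =
  subst₂ (λ s s′ → s′ + (fixedAt σ a + fixedAt σ b + fixedAt σ c) ≡ s + (fixedAt σ′ a + fixedAt σ′ b + fixedAt σ′ c))
    (sym (numFixed≡sum σ)) (sym (numFixed≡sum σ′))
    (sum-≗-except₃ {h = fixedAt σ} {fixedAt σ′} a≢b a≢c b≢c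
       (λ w w≢a w≢b w≢c → cong (λ v → indicator (v ≟ w)) (σ≗σ′ w w≢a w≢b w≢c)))

fixed+delta-step : ∀ x x′ d d′ fa fb fc {ga gb gc} →
  x′ + (fa + fb + fc) ≡ x + (ga + gb + gc) → d + fb ≡ 1 → d′ + ga ≡ 1 →
  x′ + d′ ≤ x + d + (gb + gc)
fixed+delta-step x x′ d d′ fa fb fc {ga} {gb} {gc} fixed d+fb≡1 d′+ga≡1 =
  ≤-trans (m≤m+n (x′ + d′) (fa + fc)) (≤-reflexive (+-cancelʳ-≡ 1 _ _ (begin
    x′ + d′ + (fa + fc) + 1             ≡⟨ cong (x′ + d′ + (fa + fc) +_) d+fb≡1 ⟨
    x′ + d′ + (fa + fc) + (d + fb)      ≡⟨ regroup₁ x′ d′ fa fc d fb ⟩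
    x′ + (fa + fb + fc) + d + d′        ≡⟨ cong (λ s → s + d + d′) fixed ⟩
    x + (ga + gb + gc) + d + d′         ≡⟨ regroup₂ x ga gb gc d d′ ⟩
    x + d + (gb + gc) + (d′ + ga)       ≡⟨ cong (x + d + (gb + gc) +_) d′+ga≡1 ⟩
    x + d + (gb + gc) + 1               ∎)))
  where
  open ≡-Reasoning
  regroup₁ : ∀ x d a c e b → x + d + (a + c) + (e + b) ≡ x + (a + b + c) + e + d
  regroup₁ = solve-∀
  regroup₂ : ∀ x a b c e d → x + (a + b + c) + e + d ≡ x + e + (b + c) + (d + a)
  regroup₂ = solve-∀

sorting-step : ∀ n t {c c′ y} x x′ d d′ →
  c + 2 * y ≤ c′ + 2 → x′ + d′ ≤ x + d + y →
  suc n + c′ ≤ 2 * t + 2 * x′ + 2 * d′ →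
  suc n + c ≤ 2 * suc t + 2 * x + 2 * d
sorting-step n t {c} {c′} {y} x x′ d d′ cycles fixed ih = +-cancelʳ-≤ (2 * y) _ _ (begin
  suc n + c + 2 * y               ≡⟨ +-assoc (suc n) c (2 * y) ⟩
  suc n + (c + 2 * y)             ≤⟨ +-monoʳ-≤ (suc n) cycles ⟩
  suc n + (c′ + 2)                ≡⟨ +-assoc (suc n) c′ 2 ⟨
  suc n + c′ + 2                  ≤⟨ +-monoˡ-≤ 2 ih ⟩
  2 * t + 2 * x′ + 2 * d′ + 2     ≡⟨ regroup₁ t x′ d′ ⟩
  2 * (x′ + d′) + (2 + 2 * t)     ≤⟨ +-monoˡ-≤ (2 + 2 * t) (*-monoʳ-≤ 2 fixed) ⟩
  2 * (x + d + y) + (2 + 2 * t)   ≡⟨ regroup₂ x d y t ⟩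
  2 * suc t + 2 * x + 2 * d + 2 * y ∎)
  where
  open ≤-Reasoning
  regroup₁ : ∀ t x d → 2 * t + 2 * x + 2 * d + 2 ≡ 2 * (x + d) + (2 + 2 * t)
  regroup₁ = solve-∀
  regroup₂ : ∀ x d y t → 2 * (x + d + y) + (2 + 2 * t) ≡ 2 * suc t + 2 * x + 2 * d + 2 * y
  regroup₂ = solve-∀

-- The permutation π̄

module _ {M : ℕ} where

  cycle-first : ∀ (f b : Fin M) r → cycle (f ∷ b ∷ r) f ≡ b
  cycle-first f b r with f ≟ f
  ... | yes _   = refl
  ... | no f≢f = contradiction refl f≢f

  cycle-singleton : ∀ (f : Fin M) → cycle (f ∷ []) f ≡ f
  cycle-singleton f with f ≟ f
  ... | yes _ = refl
  ... | no _  = refl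

  cycle-second : ∀ (f b c : Fin M) r → b ≢ f → cycle (f ∷ b ∷ c ∷ r) b ≡ c
  cycle-second f b c r b≢f with b ≟ f
  ... | yes b≡f = contradiction b≡f b≢f
  ... | no _ with b ≟ b
  ...   | yes _   = refl
  ...   | no b≢b = contradiction refl b≢b

  cycle-wrap : ∀ (f b : Fin M) → b ≢ f → cycle (f ∷ b ∷ []) b ≡ f
  cycle-wrap f b b≢f with b ≟ f
  ... | yes b≡f = contradiction b≡f b≢f
  ... | no _ with b ≟ b
  ...   | yes _   = refl
  ...   | no b≢b = contradiction refl b≢b

  cycle-skip : ∀ (f b c : Fin M) r {x} → x ≢ f → x ≢ b → cycle (f ∷ b ∷ c ∷ r) x ≡ cycle (f ∷ c ∷ r) x
  cycle-skip f b c r {x} x≢f x≢b with x ≟ f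
  ... | yes x≡f = contradiction x≡f x≢f
  ... | no _ with x ≟ b
  ...   | yes x≡b = contradiction x≡b x≢b
  ...   | no _    = refl

  module _ (f : Fin M) where

    cycle-∷-tabulate-last : ∀ k {G : Fin (suc k) → Fin M} → Injective _≡_ _≡_ G → (∀ i → G i ≢ f) →
                            ∀ i → k ≡ toℕ i → cycle (f ∷ tabulate G) (G i) ≡ f
    cycle-∷-tabulate-last zero    inj G≢f Fin.zero    _ = cycle-wrap f _ (G≢f Fin.zero)
    cycle-∷-tabulate-last (suc k) {G} inj G≢f (Fin.suc i) e =
      trans (cycle-skip f (G Fin.zero) (G (Fin.suc Fin.zero)) (tabulate (G ∘ Fin.suc ∘ Fin.suc)) (G≢f _) (Fin.0≢1+n ∘ sym ∘ inj))
            (cycle-∷-tabulate-last k (Fin.suc-injective ∘ inj) (G≢f ∘ Fin.suc) i (suc-injective e))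

    cycle-∷-tabulate-step : ∀ k {G : Fin (suc k) → Fin M} → Injective _≡_ _≡_ G → (∀ i → G i ≢ f) →
                            ∀ i (k≢i : k ≢ toℕ i) → cycle (f ∷ tabulate G) (G i) ≡ G (Fin.suc (Fin.lower₁ i k≢i))
    cycle-∷-tabulate-step zero    inj G≢f Fin.zero    0≢0 = contradiction refl 0≢0
    cycle-∷-tabulate-step (suc k) {G} inj G≢f Fin.zero _ =
      cycle-second f (G Fin.zero) (G (Fin.suc Fin.zero)) (tabulate (G ∘ Fin.suc ∘ Fin.suc)) (G≢f Fin.zero)
    cycle-∷-tabulate-step (suc k) {G} inj G≢f (Fin.suc i) k≢i =
      trans (cycle-skip f (G Fin.zero) (G (Fin.suc Fin.zero)) (tabulate (G ∘ Fin.suc ∘ Fin.suc)) (G≢f _) (Fin.0≢1+n ∘ sym ∘ inj))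
            (cycle-∷-tabulate-step k (Fin.suc-injective ∘ inj) (G≢f ∘ Fin.suc) i (k≢i ∘ cong suc))

rotate : ∀ n → Fin (suc n) → Fin (suc n)
rotate n p with n ℕ.≟ toℕ p
... | yes _   = Fin.zero
... | no n≢p = Fin.suc (Fin.lower₁ p n≢p)

unrotate : ∀ n → Fin (suc n) → Fin (suc n)
unrotate n Fin.zero    = Fin.fromℕ n
unrotate n (Fin.suc i) = Fin.inject₁ i

rotate-unrotate : ∀ n p → rotate n (unrotate n p) ≡ p
rotate-unrotate n Fin.zero with n ℕ.≟ toℕ (Fin.fromℕ n)
... | yes _   = refl
... | no n≢n = contradiction (sym (Fin.toℕ-fromℕ n)) n≢n
rotate-unrotate n (Fin.suc i) with n ℕ.≟ toℕ (Fin.inject₁ i)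
... | yes n≡i = contradiction n≡i (Fin.toℕ-inject₁-≢ i)
... | no n≢i  = cong Fin.suc (Fin.lower₁-inject₁′ i n≢i)

unrotate-rotate : ∀ n p → unrotate n (rotate n p) ≡ p
unrotate-rotate n p with n ℕ.≟ toℕ p
... | yes n≡p = toℕ-injective (trans (Fin.toℕ-fromℕ n) n≡p)
... | no n≢p  = Fin.inject₁-lower₁ p n≢p

cycle-tabulate : ∀ {M} k {H : Fin (suc k) → Fin M} → Injective _≡_ _≡_ H →
                 ∀ i → cycle (tabulate H) (H i) ≡ H (rotate k i)
cycle-tabulate k {H} inj i with k ℕ.≟ toℕ i
cycle-tabulate zero    {H} inj Fin.zero    | yes _ = cycle-singleton (H Fin.zero)
cycle-tabulate (suc k) {H} inj (Fin.suc i) | yes k≡i =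
  cycle-∷-tabulate-last (H Fin.zero) k (Fin.suc-injective ∘ inj) (λ _ → Fin.0≢1+n ∘ sym ∘ inj) i (suc-injective k≡i)
cycle-tabulate zero    {H} inj Fin.zero    | no 0≢0 = contradiction refl 0≢0
cycle-tabulate (suc k) {H} inj Fin.zero    | no _ = cycle-first (H Fin.zero) (H (Fin.suc Fin.zero)) (tabulate (H ∘ Fin.suc ∘ Fin.suc))
cycle-tabulate (suc k) {H} inj (Fin.suc i) | no k≢i =
  cycle-∷-tabulate-step (H Fin.zero) k (Fin.suc-injective ∘ inj) (λ _ → Fin.0≢1+n ∘ sym ∘ inj) i (k≢i ∘ cong suc)

sucMod : ℕ → ℕ → ℕ
sucMod n x with n ℕ.≟ x
... | yes _ = 0
... | no _  = suc x

predMod : ℕ → ℕ → ℕ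
predMod n zero    = n
predMod n (suc x) = x

toℕ-rotate : ∀ n p → toℕ (rotate n p) ≡ sucMod n (toℕ p)
toℕ-rotate n p with n ℕ.≟ toℕ p
... | yes _   = refl
... | no n≢p = cong suc (Fin.toℕ-lower₁ p n≢p)

toℕ-unrotate : ∀ n p → toℕ (unrotate n p) ≡ predMod n (toℕ p)
toℕ-unrotate n Fin.zero    = Fin.toℕ-fromℕ n
toℕ-unrotate n (Fin.suc i) = Fin.toℕ-inject₁ i

reflect : ∀ {n} → Fin (suc n) → Fin (suc n)
reflect Fin.zero    = Fin.zero
reflect (Fin.suc i) = Fin.suc (Fin.opposite i)

reflect-involutive : ∀ {n} (p : Fin (suc n)) → reflect (reflect p) ≡ p
reflect-involutive Fin.zero    = refl
reflect-involutive (Fin.suc i) = cong Fin.suc (Fin.opposite-involutive i)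

reflectℕ : ℕ → ℕ → ℕ
reflectℕ n zero    = 0
reflectℕ n (suc x) = n ∸ x

toℕ-reflect : ∀ {n} (p : Fin (suc n)) → toℕ (reflect p) ≡ reflectℕ n (toℕ p)
toℕ-reflect Fin.zero    = refl
toℕ-reflect (Fin.suc i) = trans (cong suc (Fin.opposite-prop i)) (sym (+-∸-assoc 1 (Fin.toℕ<n i)))

reflectℕ-sucMod-reflectℕ : ∀ n x → x ≤ n → reflectℕ n (sucMod n (reflectℕ n x)) ≡ predMod n x
reflectℕ-sucMod-reflectℕ n zero _ with n ℕ.≟ 0
... | yes refl = refl
... | no _     = refl
reflectℕ-sucMod-reflectℕ n (suc y) y<n with n ℕ.≟ n ∸ y
... | yes n≡n∸y = sym (trans (sym (m∸[m∸n]≡n (<⇒≤ y<n))) (trans (cong (n ∸_) (sym n≡n∸y)) (n∸n≡0 n)))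
... | no _       = m∸[m∸n]≡n (<⇒≤ y<n)

reflect-rotate-reflect : ∀ n p → reflect (rotate n (reflect p)) ≡ unrotate n p
reflect-rotate-reflect n p = toℕ-injective (begin
  toℕ (reflect (rotate n (reflect p)))          ≡⟨ toℕ-reflect (rotate n (reflect p)) ⟩
  reflectℕ n (toℕ (rotate n (reflect p)))       ≡⟨ cong (reflectℕ n) (toℕ-rotate n (reflect p)) ⟩
  reflectℕ n (sucMod n (toℕ (reflect p)))       ≡⟨ cong (reflectℕ n ∘ sucMod n) (toℕ-reflect p) ⟩
  reflectℕ n (sucMod n (reflectℕ n (toℕ p)))    ≡⟨ reflectℕ-sucMod-reflectℕ n (toℕ p) (toℕ≤pred[n] p) ⟩
  predMod n (toℕ p)                             ≡⟨ toℕ-unrotate n p ⟨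
  toℕ (unrotate n p)                            ∎)
  where open ≡-Reasoning

tabulate-∷ʳ : ∀ {A : Set} n (h : Fin (suc n) → A) → tabulate h ≡ tabulate (h ∘ Fin.inject₁) ∷ʳ h (Fin.fromℕ n)
tabulate-∷ʳ zero    h = refl
tabulate-∷ʳ (suc n) h = cong (h Fin.zero ∷_) (tabulate-∷ʳ n (h ∘ Fin.suc))

reverse-tabulate : ∀ {A : Set} n (h : Fin n → A) → reverse (tabulate h) ≡ tabulate (h ∘ Fin.opposite)
reverse-tabulate zero    h = refl
reverse-tabulate (suc n) h = begin
  reverse (tabulate h)                                         ≡⟨ cong reverse (tabulate-∷ʳ n h) ⟩
  reverse (tabulate (h ∘ Fin.inject₁) ∷ʳ h (Fin.fromℕ n))      ≡⟨ reverse-++ (tabulate (h ∘ Fin.inject₁)) _ ⟩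
  h (Fin.fromℕ n) ∷ reverse (tabulate (h ∘ Fin.inject₁))       ≡⟨ cong (h (Fin.fromℕ n) ∷_) (reverse-tabulate n (h ∘ Fin.inject₁)) ⟩
  tabulate (h ∘ Fin.opposite)                                  ∎
  where open ≡-Reasoning

lift₀ : ∀ {n} → (Fin n → Fin n) → Fin (suc n) → Fin (suc n)
lift₀ g Fin.zero    = Fin.zero
lift₀ g (Fin.suc i) = Fin.suc (g i)

lift₀-injective : ∀ {n} {g : Fin n → Fin n} → Injective _≡_ _≡_ g → Injective _≡_ _≡_ (lift₀ g)
lift₀-injective inj {Fin.zero}  {Fin.zero}  _ = refl
lift₀-injective inj {Fin.suc _} {Fin.suc _} e = cong Fin.suc (inj (Fin.suc-injective e))

-- piBar π = piBarFun (π ⟨$⟩ʳ_) and delta π = deltaFun (π ⟨$⟩ʳ_); the induction runs over the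
-- functions π ∘ s₁ ∘ ⋯ ∘ sᵢ, whose injectivity is recovered from the sorting hypothesis.
piBarFun : ∀ {n} → (Fin n → Fin n) → Fin (suc n) → Fin (suc n)
piBarFun {n} g = cycle (allFin (suc n)) ∘ cycle (Fin.zero ∷ reverse (map (λ i → Fin.suc (g i)) (allFin n)))

deltaFun : ∀ {n} → (Fin n → Fin n) → ℕ
deltaFun {zero}  g = 0
deltaFun {suc n} g = if does (g Fin.zero ≟ Fin.zero) then 0 else 1


piBar-lift₀ : ∀ {n} {g : Fin n → Fin n} → Injective _≡_ _≡_ g →
              ∀ p → piBarFun g (lift₀ g p) ≡ rotate n (lift₀ g (unrotate n p))
piBar-lift₀ {n} {g} inj p = begin
  piBarFun g (lift₀ g p)
    ≡⟨ cong (cycle (allFin (suc n)) ∘ cycle L ∘ lift₀ g) (reflect-involutive p) ⟨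
  cycle (allFin (suc n)) (cycle L (lift₀ g (reflect (reflect p))))
    ≡⟨ cong (λ L′ → cycle (allFin (suc n)) (cycle (Fin.zero ∷ L′) (lift₀ g (reflect (reflect p))))) L≡ ⟩
  cycle (allFin (suc n)) (cycle (tabulate (lift₀ g ∘ reflect)) (lift₀ g (reflect (reflect p))))
    ≡⟨ cong (cycle (allFin (suc n))) (cycle-tabulate n (reflect-injective ∘ lift₀-injective inj) (reflect p)) ⟩
  cycle (allFin (suc n)) (lift₀ g (reflect (rotate n (reflect p))))
    ≡⟨ cong (cycle (allFin (suc n)) ∘ lift₀ g) (reflect-rotate-reflect n p) ⟩
  cycle (tabulate id) (lift₀ g (unrotate n p))
    ≡⟨ cycle-tabulate n id (lift₀ g (unrotate n p)) ⟩
  rotate n (lift₀ g (unrotate n p))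
    ∎
  where
  open ≡-Reasoning
  L = Fin.zero ∷ reverse (map (λ i → Fin.suc (g i)) (allFin n))
  L≡ : reverse (map (λ i → Fin.suc (g i)) (allFin n)) ≡ tabulate (Fin.suc ∘ g ∘ Fin.opposite)
  L≡ = trans (cong reverse (map-tabulate id (λ i → Fin.suc (g i)))) (reverse-tabulate n (λ i → Fin.suc (g i)))
  reflect-injective : Injective _≡_ _≡_ (reflect {n})
  reflect-injective {x} {y} e = trans (sym (reflect-involutive x)) (trans (cong reflect e) (reflect-involutive y))

-- Positions moved by a prefix transposition

sucMod-n : ∀ n → sucMod n n ≡ 0
sucMod-n n with n ℕ.≟ n
... | yes _   = refl
... | no n≢n = contradiction refl n≢n

sucMod-< : ∀ {n x} → x < n → sucMod n x ≡ suc x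
sucMod-< {n} {x} x<n with n ℕ.≟ x
... | yes n≡x = contradiction (sym n≡x) (<⇒≢ x<n)
... | no _    = refl

≢-sucMod : ∀ {n m s} → s ≢ 0 → s ≢ suc m → s ≢ sucMod n m
≢-sucMod {n} {m} s≢0 s≢1+m with n ℕ.≟ m
... | yes _ = s≢0
... | no _  = s≢1+m

ptℕ : ℕ → ℕ → ℕ → ℕ
ptℕ j₁ k x with k ≤? x
... | no _ = j₁ + x
... | yes _ with j₁ + k ≤? x
...   | no _  = x ∸ k
...   | yes _ = x

ptℕ-< : ∀ j₁ k {x} → x < k → ptℕ j₁ k x ≡ j₁ + x
ptℕ-< j₁ k {x} x<k with k ≤? x
... | no _    = refl
... | yes k≤x = contradiction k≤x (<⇒≱ x<k)

ptℕ-∸ : ∀ j₁ k {x} → k ≤ x → x < j₁ + k → ptℕ j₁ k x ≡ x ∸ k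
ptℕ-∸ j₁ k {x} k≤x x<j₁+k with k ≤? x
... | no k≰x = contradiction k≤x k≰x
... | yes _ with j₁ + k ≤? x
...   | no _       = refl
...   | yes j₁+k≤x = contradiction j₁+k≤x (<⇒≱ x<j₁+k)

ptℕ-≥ : ∀ j₁ k {x} → j₁ + k ≤ x → ptℕ j₁ k x ≡ x
ptℕ-≥ j₁ k {x} j₁+k≤x with k ≤? x
... | no k≰x = contradiction (≤-trans (m≤n+m k j₁) j₁+k≤x) k≰x
... | yes _ with j₁ + k ≤? x
...   | no j₁+k≰x = contradiction j₁+k≤x j₁+k≰x
...   | yes _     = refl

l∸1≡j∸1+l∸j : ∀ {j l} → 1 ≤ j → j ≤ l → l ∸ 1 ≡ (j ∸ 1) + (l ∸ j)
l∸1≡j∸1+l∸j {suc j} {suc l} _ (s≤s j≤l) = sym (m+[n∸m]≡n j≤l)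

toℕ-ptFun : ∀ {n} (S : PrefixTransposition n) p →
            toℕ (ptFun S p) ≡ ptℕ (PrefixTransposition.j S ∸ 1) (PrefixTransposition.l S ∸ PrefixTransposition.j S) (toℕ p)
toℕ-ptFun {n} (pt j l 1<j j<l l≤n+1) p with suc (toℕ p) ≤? l ∸ j
... | yes p<l∸j with j ∸ 1 + toℕ p <? n
...   | yes v<n = trans (Fin.toℕ-fromℕ< v<n) (sym (ptℕ-< (j ∸ 1) (l ∸ j) p<l∸j))
...   | no v≮n  = contradiction (≤-trans (+-monoʳ-< (j ∸ 1) p<l∸j) (≤-trans (≤-reflexive (sym l∸1≡)) (∸-monoˡ-≤ 1 l≤n+1))) v≮n
  where l∸1≡ = l∸1≡j∸1+l∸j (<⇒≤ 1<j) (<⇒≤ j<l)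
toℕ-ptFun {n} (pt j l 1<j j<l l≤n+1) p | no p≮l∸j with suc (toℕ p) ≤? l ∸ 1
... | yes p<l∸1 with toℕ p ∸ (l ∸ j) <? n
...   | yes v<n = trans (Fin.toℕ-fromℕ< v<n)
                        (sym (ptℕ-∸ (j ∸ 1) (l ∸ j) (≮⇒≥ p≮l∸j) (subst (toℕ p <_) (l∸1≡j∸1+l∸j (<⇒≤ 1<j) (<⇒≤ j<l)) p<l∸1)))
...   | no v≮n  = contradiction (≤-<-trans (m∸n≤m (toℕ p) (l ∸ j)) (Fin.toℕ<n p)) v≮n
toℕ-ptFun {n} (pt j l 1<j j<l l≤n+1) p | no p≮l∸j | no p≮l∸1 =
  sym (ptℕ-≥ (j ∸ 1) (l ∸ j) (subst (_≤ toℕ p) (l∸1≡j∸1+l∸j (<⇒≤ 1<j) (<⇒≤ j<l)) (≮⇒≥ p≮l∸1)))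

data Cycled₃ (J B L S R : ℕ) : Set where
  at-J      : S ≡ J → R ≡ B → Cycled₃ J B L S R
  at-B      : S ≡ B → R ≡ L → Cycled₃ J B L S R
  at-L      : S ≡ L → R ≡ J → Cycled₃ J B L S R
  elsewhere : S ≢ J → S ≢ B → S ≢ L → R ≡ S → Cycled₃ J B L S R

Cycled₃-resp : ∀ {J B L S S′ R R′} → S ≡ S′ → R ≡ R′ → Cycled₃ J B L S′ R′ → Cycled₃ J B L S R
Cycled₃-resp refl refl c = c

cycle₃-Cycled₃ : ∀ {m} {a b c s r : Fin m} {A B C S R} → a ≢ b → a ≢ c → b ≢ c →
                 toℕ a ≡ A → toℕ b ≡ B → toℕ c ≡ C → toℕ s ≡ S → toℕ r ≡ R →
                 Cycled₃ A B C S R → cycle₃ a b c s ≡ r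
cycle₃-Cycled₃ a≢b a≢c b≢c refl refl refl refl refl (at-J s≡a r≡b) with toℕ-injective s≡a | toℕ-injective r≡b
... | refl | refl = cycle₃-a a≢b a≢c b≢c
cycle₃-Cycled₃ a≢b a≢c b≢c refl refl refl refl refl (at-B s≡b r≡c) with toℕ-injective s≡b | toℕ-injective r≡c
... | refl | refl = cycle₃-b a≢b a≢c b≢c
cycle₃-Cycled₃ a≢b a≢c b≢c refl refl refl refl refl (at-L s≡c r≡a) with toℕ-injective s≡c | toℕ-injective r≡a
... | refl | refl = cycle₃-c a≢b a≢c b≢c
cycle₃-Cycled₃ a≢b a≢c b≢c refl refl refl refl refl (elsewhere s≢a s≢b s≢c r≡s) =
  trans (cycle₃-≢ a≢b a≢c b≢c (s≢a ∘ cong toℕ) (s≢b ∘ cong toℕ) (s≢c ∘ cong toℕ)) (toℕ-injective (sym r≡s))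

liftℕ : (ℕ → ℕ) → ℕ → ℕ
liftℕ f zero    = 0
liftℕ f (suc x) = suc (f x)

-- ρ ŝ ρ⁻¹ = (j₁+1 1 ρ(j₁+k)) ŝ at the point P, read on ℕ, for ŝ moving the first j₁ positions behind the next k.
RotConj : ℕ → ℕ → ℕ → ℕ → Set
RotConj j₁ k n P = Cycled₃ (suc j₁) 1 (sucMod n (j₁ + k)) (ŝ P) (sucMod n (ŝ (predMod n P)))
  where ŝ = liftℕ (ptℕ j₁ k)

rotConj-0 : ∀ a b n → suc a + suc b ≤ n → RotConj (suc a) (suc b) n 0
rotConj-0 a b (suc n′) fits with <-cmp (suc a + suc b) (suc n′)
... | tri< j₁+k<n _ _ =
  Cycled₃-resp refl (trans (cong (sucMod (suc n′) ∘ suc) (ptℕ-≥ (suc a) (suc b) (≤-pred j₁+k<n))) (sucMod-n (suc n′)))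
    (elsewhere (λ ()) (λ ()) (λ 0≡L → 0≢1+n (trans 0≡L (sucMod-< j₁+k<n))) refl)
... | tri≈ _ j₁+k≡n _ =
  at-L (sym (trans (cong (sucMod (suc n′)) j₁+k≡n) (sucMod-n (suc n′))))
       (trans (cong (sucMod (suc n′) ∘ suc) ptℕ≡a) (sucMod-< (s≤s (subst (a <_) n′≡ (m<m+n a z<s)))))
  where
  n′≡ : a + suc b ≡ n′
  n′≡ = suc-injective j₁+k≡n
  ptℕ≡a : ptℕ (suc a) (suc b) n′ ≡ a
  ptℕ≡a = trans (ptℕ-∸ (suc a) (suc b) (subst (suc b ≤_) n′≡ (m≤n+m (suc b) a)) (subst (_< suc a + suc b) n′≡ (n<1+n _)))
                (trans (cong (_∸ suc b) (sym n′≡)) (m+n∸n≡m a (suc b)))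
... | tri> _ _ n<j₁+k = contradiction fits (<⇒≱ n<j₁+k)

rotConj-first-block : ∀ a b n x → x < suc b → suc a + suc b ≤ n → RotConj (suc a) (suc b) n (suc x)
rotConj-first-block a b n zero    _ fits =
  at-J (cong suc (trans (ptℕ-< (suc a) (suc b) z<s) (+-identityʳ (suc a)))) (sucMod-< (<-≤-trans z<s fits))
rotConj-first-block a b n (suc y) y<b fits =
  Cycled₃-resp (cong suc (ptℕ-< (suc a) (suc b) y<b))
               (trans (cong (sucMod n ∘ suc) (ptℕ-< (suc a) (suc b) (<-trans (n<1+n y) y<b))) (sucMod-< j₁+y<n))
    (elsewhere (m+1+n≢m (suc a) ∘ suc-injective) (λ ())
               (≢-sucMod (λ ()) (<⇒≢ (+-monoʳ-< (suc a) y<b) ∘ suc-injective))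
               (cong suc (sym (+-suc (suc a) y))))
  where
  j₁+y<n : suc (suc a + y) < n
  j₁+y<n = <-≤-trans (subst (_< suc a + suc b) (+-suc (suc a) y) (+-monoʳ-< (suc a) y<b)) fits

rotConj-block-boundary : ∀ a b n → suc a + suc b ≤ n → RotConj (suc a) (suc b) n (suc (suc b))
rotConj-block-boundary a b n fits =
  at-B (cong suc (trans (ptℕ-∸ (suc a) (suc b) ≤-refl (m<n+m (suc b) z<s)) (n∸n≡0 (suc b))))
       (cong (sucMod n) (trans (cong suc (ptℕ-< (suc a) (suc b) ≤-refl)) (sym (+-suc (suc a) b))))

rotConj-second-block : ∀ a b n x → suc b < x → x < suc a + suc b → suc a + suc b ≤ n → RotConj (suc a) (suc b) n (suc x)
rotConj-second-block a b n (suc y) b<y x<j₁+k fits =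
  Cycled₃-resp (cong suc (ptℕ-∸ (suc a) (suc b) (<⇒≤ b<y) x<j₁+k))
               (trans (cong (sucMod n ∘ suc) (ptℕ-∸ (suc a) (suc b) (≤-pred b<y) (<-trans (n<1+n y) x<j₁+k)))
                      (sucMod-< (<-≤-trans y∸k<j₁ (≤-trans (m≤m+n (suc a) (suc b)) fits))))
    (elsewhere (<⇒≢ x∸k<j₁ ∘ suc-injective) (m>n⇒m∸n≢0 b<y ∘ suc-injective)
               (≢-sucMod (λ ()) (<⇒≢ (<-≤-trans x∸k<j₁ (m≤m+n (suc a) (suc b))) ∘ suc-injective))
               (cong suc (sym (+-∸-assoc 1 (≤-pred b<y)))))
  where
  x∸k<j₁ : suc y ∸ suc b < suc a
  x∸k<j₁ = +-cancelʳ-< (suc b) _ _ (subst (_< suc a + suc b) (sym (m∸n+n≡m (<⇒≤ b<y))) x<j₁+k)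
  y∸k<j₁ : suc (y ∸ suc b) < suc a
  y∸k<j₁ = subst (_< suc a) (+-∸-assoc 1 (≤-pred b<y)) x∸k<j₁

rotConj-block-end : ∀ a b n → suc (suc a + suc b) ≤ n → RotConj (suc a) (suc b) n (suc (suc a + suc b))
rotConj-block-end a b n j₁+k<n =
  at-L (trans (cong suc (ptℕ-≥ (suc a) (suc b) ≤-refl)) (sym (sucMod-< j₁+k<n)))
       (trans (cong (sucMod n ∘ suc) ptℕ≡a) (sucMod-< (<-≤-trans (m<m+n (suc a) z<s) (<⇒≤ j₁+k<n))))
  where
  ptℕ≡a : ptℕ (suc a) (suc b) (a + suc b) ≡ a
  ptℕ≡a = trans (ptℕ-∸ (suc a) (suc b) (m≤n+m (suc b) a) (n<1+n _)) (m+n∸n≡m a (suc b))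

rotConj-beyond : ∀ a b n x → suc a + suc b < x → suc x ≤ n → RotConj (suc a) (suc b) n (suc x)
rotConj-beyond a b n (suc y) j₁+k<x x<n =
  Cycled₃-resp (cong suc (ptℕ-≥ (suc a) (suc b) (<⇒≤ j₁+k<x)))
               (trans (cong (sucMod n ∘ suc) (ptℕ-≥ (suc a) (suc b) (≤-pred j₁+k<x))) (sucMod-< x<n))
    (elsewhere (λ e → <⇒≢ (≤-trans (s≤s (m≤m+n (suc a) (suc b))) j₁+k<x) (sym (suc-injective e))) (λ ())
               (≢-sucMod (λ ()) (λ e → <⇒≢ j₁+k<x (sym (suc-injective e))))
               refl)

rotConj : ∀ j₁ k n P → 1 ≤ j₁ → 1 ≤ k → j₁ + k ≤ n → P ≤ n → RotConj j₁ k n P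
rotConj (suc a) (suc b) n zero    _ _ fits _ = rotConj-0 a b n fits
rotConj (suc a) (suc b) n (suc x) _ _ fits P≤n with <-cmp x (suc b)
... | tri< x<k _ _ = rotConj-first-block a b n x x<k fits
... | tri≈ _ refl _ = rotConj-block-boundary a b n fits
... | tri> _ _ k<x with <-cmp x (suc a + suc b)
...   | tri< x<j₁+k _ _ = rotConj-second-block a b n x k<x x<j₁+k fits
...   | tri≈ _ refl _   = rotConj-block-end a b n P≤n
...   | tri> _ _ j₁+k<x = rotConj-beyond a b n x j₁+k<x P≤n

≢-via-toℕ : ∀ {m} {x y : Fin m} {X Y} → toℕ x ≡ X → toℕ y ≡ Y → X ≢ Y → x ≢ y
≢-via-toℕ refl refl X≢Y = X≢Y ∘ cong toℕ

module PrefixTranspositionMoves {n} (S : PrefixTransposition n) where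
  open PrefixTransposition S

  j₁ k : ℕ
  j₁ = j ∸ 1
  k  = l ∸ j

  1≤j₁ : 1 ≤ j₁
  1≤j₁ = ∸-monoˡ-≤ 1 1<j

  1≤k : 1 ≤ k
  1≤k = subst (_≤ l ∸ j) (m+n∸n≡m 1 j) (∸-monoˡ-≤ j j<l)

  j₁+k≤n : j₁ + k ≤ n
  j₁+k≤n = subst (_≤ n) (l∸1≡j∸1+l∸j (<⇒≤ 1<j) (<⇒≤ j<l)) (∸-monoˡ-≤ 1 l≤n+1)

  ŝ : Fin (suc n) → Fin (suc n)
  ŝ = lift₀ (ptFun S)

  toℕ-ŝ : ∀ p → toℕ (ŝ p) ≡ liftℕ (ptℕ j₁ k) (toℕ p)
  toℕ-ŝ Fin.zero    = refl
  toℕ-ŝ (Fin.suc i) = cong suc (toℕ-ptFun S i)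

  j₁<n : j₁ < n
  j₁<n = <-≤-trans (m<m+n j₁ 1≤k) j₁+k≤n

  0<n : 0 < n
  0<n = ≤-<-trans z≤n j₁<n

  posJ posB posL : Fin (suc n)
  posJ = Fin.fromℕ< (s≤s j₁<n)
  posB = Fin.fromℕ< (s≤s 0<n)
  posL = rotate n (Fin.fromℕ< (s≤s j₁+k≤n))

  toℕ-posJ : toℕ posJ ≡ suc j₁
  toℕ-posJ = Fin.toℕ-fromℕ< (s≤s j₁<n)

  toℕ-posB : toℕ posB ≡ 1
  toℕ-posB = Fin.toℕ-fromℕ< (s≤s 0<n)

  toℕ-posL : toℕ posL ≡ sucMod n (j₁ + k)
  toℕ-posL = trans (toℕ-rotate n _) (cong (sucMod n) (Fin.toℕ-fromℕ< (s≤s j₁+k≤n)))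

  posJ≢posB : posJ ≢ posB
  posJ≢posB = ≢-via-toℕ toℕ-posJ toℕ-posB (<⇒≢ (s≤s 1≤j₁) ∘ sym)

  posJ≢posL : posJ ≢ posL
  posJ≢posL = ≢-via-toℕ toℕ-posJ toℕ-posL (≢-sucMod (λ ()) (<⇒≢ (s≤s (m<m+n j₁ 1≤k))))

  posB≢posL : posB ≢ posL
  posB≢posL = ≢-via-toℕ toℕ-posB toℕ-posL (≢-sucMod (λ ()) (<⇒≢ (≤-trans 1≤j₁ (m≤m+n j₁ k)) ∘ suc-injective))

  ŝ-posB : ŝ posB ≡ posJ
  ŝ-posB = toℕ-injective (begin
    toℕ (ŝ posB)                    ≡⟨ toℕ-ŝ posB ⟩
    liftℕ (ptℕ j₁ k) (toℕ posB)     ≡⟨ cong (liftℕ (ptℕ j₁ k)) toℕ-posB ⟩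
    suc (ptℕ j₁ k 0)                ≡⟨ cong suc (trans (ptℕ-< j₁ k 1≤k) (+-identityʳ j₁)) ⟩
    suc j₁                          ≡⟨ toℕ-posJ ⟨
    toℕ posJ                        ∎)
    where open ≡-Reasoning

  ŝ-conj : ∀ p → cycle₃ posJ posB posL (ŝ p) ≡ rotate n (ŝ (unrotate n p))
  ŝ-conj p = cycle₃-Cycled₃ posJ≢posB posJ≢posL posB≢posL toℕ-posJ toℕ-posB toℕ-posL (toℕ-ŝ p)
    (trans (toℕ-rotate n _) (cong (sucMod n) (trans (toℕ-ŝ (unrotate n p)) (cong (liftℕ (ptℕ j₁ k)) (toℕ-unrotate n p)))))
    (rotConj j₁ k n (toℕ p) 1≤j₁ 1≤k j₁+k≤n (toℕ≤pred[n] p))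

-- The lower bound

injective⇒surjective : ∀ {n} {h : Fin n → Fin n} → Injective _≡_ _≡_ h → ∀ z → ∃ λ y → h y ≡ z
injective⇒surjective {suc n} {h} inj z with Fin.any? (λ y → h y ≟ z)
... | yes hit = hit
... | no miss = contradiction (Fin.injective⇒≤ punchOut-injective) 1+n≰n
  where
  punchOut-injective : Injective _≡_ _≡_ (λ y → Fin.punchOut {i = z} {j = h y} (λ z≡hy → miss (y , sym z≡hy)))
  punchOut-injective {x} {y} e = inj (Fin.punchOut-injective (λ z≡hx → miss (x , sym z≡hx)) (λ z≡hy → miss (y , sym z≡hy)) e)

composeAll-∘ : ∀ {n} (f h : Fin n → Fin n) ss x → composeAll (f ∘ h) ss x ≡ f (composeAll h ss x)
composeAll-∘ f h []       x = refl
composeAll-∘ f h (s ∷ ss) x = composeAll-∘ f (h ∘ ptFun s) ss x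

hasLeftInverse⇒injective : ∀ {n} {g h : Fin n → Fin n} → (∀ i → g (h i) ≡ i) → Injective _≡_ _≡_ h
hasLeftInverse⇒injective {g = g} g∘h≗id {i} {i′} e = trans (sym (g∘h≗id i)) (trans (cong g e) (g∘h≗id i′))

hasRightInverse⇒injective : ∀ {n} {g h : Fin n → Fin n} → (∀ i → g (h i) ≡ i) → Injective _≡_ _≡_ g
hasRightInverse⇒injective {g = g} {h} g∘h≗id {x} {y} gx≡gy
  with x′ , refl ← injective⇒surjective (hasLeftInverse⇒injective {g = g} {h} g∘h≗id) x
     | y′ , refl ← injective⇒surjective (hasLeftInverse⇒injective {g = g} {h} g∘h≗id) y
  = cong h (trans (sym (g∘h≗id x′)) (trans gx≡gy (g∘h≗id y′)))

sorted⇒injective : ∀ {n} {g : Fin n → Fin n} ss → (∀ i → composeAll g ss i ≡ i) → Injective _≡_ _≡_ g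
sorted⇒injective {g = g} ss sorted = hasRightInverse⇒injective (λ i → trans (sym (composeAll-∘ g id ss i)) (sorted i))

lift₀-∘ : ∀ {n} (g h : Fin n → Fin n) p → lift₀ (g ∘ h) p ≡ lift₀ g (lift₀ h p)
lift₀-∘ g h Fin.zero    = refl
lift₀-∘ g h (Fin.suc i) = refl

piBar-injective : ∀ {n} {g : Fin n → Fin n} → Injective _≡_ _≡_ g → Injective _≡_ _≡_ (piBarFun g)
piBar-injective {n} {g} inj {x} {y} e
  with p , refl ← injective⇒surjective (lift₀-injective inj) x
     | q , refl ← injective⇒surjective (lift₀-injective inj) y
  = cong (lift₀ g) (begin
    p                                  ≡⟨ rotate-unrotate n p ⟨
    rotate n (unrotate n p)            ≡⟨ cong (rotate n) (lift₀-injective inj (rotate-injective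
                                            (trans (sym (piBar-lift₀ inj p)) (trans e (piBar-lift₀ inj q))))) ⟩
    rotate n (unrotate n q)            ≡⟨ rotate-unrotate n q ⟩
    q                                  ∎)
  where
  open ≡-Reasoning
  rotate-injective : Injective _≡_ _≡_ (rotate n)
  rotate-injective {u} {v} e′ = trans (sym (unrotate-rotate n u)) (trans (cong (unrotate n) e′) (unrotate-rotate n v))

deltaFun+fixedAt≡1 : ∀ {n} {g : Fin (suc n) → Fin (suc n)} → Injective _≡_ _≡_ g →
                     deltaFun g + fixedAt (piBarFun g) (lift₀ g (Fin.suc Fin.zero)) ≡ 1
deltaFun+fixedAt≡1 {n} {g} inj
  with π̄π₁≡1 ← piBar-lift₀ inj (Fin.suc Fin.zero)
  with g Fin.zero ≟ Fin.zero
... | yes g0≡0 = indicator-yes (_ ≟ _) (trans π̄π₁≡1 (cong Fin.suc (sym g0≡0)))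
... | no g0≢0  = cong suc (indicator-no (_ ≟ _) (g0≢0 ∘ sym ∘ Fin.suc-injective ∘ trans (sym π̄π₁≡1)))

module _ {n} {g : Fin (suc n) → Fin (suc n)} (s : PrefixTransposition (suc n))
         (g-injective : Injective _≡_ _≡_ g) (g∘s-injective : Injective _≡_ _≡_ (g ∘ ptFun s)) where
  open PrefixTranspositionMoves s

  private
    σ σ′ : Fin (suc (suc n)) → Fin (suc (suc n))
    σ  = piBarFun g
    σ′ = piBarFun (g ∘ ptFun s)
    a b c : Fin (suc (suc n))
    a = lift₀ g posJ
    b = lift₀ g posB
    c = lift₀ g posL
    a≢b : a ≢ b
    a≢b = posJ≢posB ∘ lift₀-injective g-injective
    a≢c : a ≢ c
    a≢c = posJ≢posL ∘ lift₀-injective g-injective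
    b≢c : b ≢ c
    b≢c = posB≢posL ∘ lift₀-injective g-injective

  piBar-∘ptFun : ∀ w → piBarFun (g ∘ ptFun s) w ≡ piBarFun g (cycle₃ (lift₀ g posJ) (lift₀ g posB) (lift₀ g posL) w)
  piBar-∘ptFun w with p , refl ← injective⇒surjective (lift₀-injective g∘s-injective) w = begin
    piBarFun g′ (lift₀ g′ p)
      ≡⟨ piBar-lift₀ g∘s-injective p ⟩
    rotate (suc n) (lift₀ g′ (unrotate (suc n) p))
      ≡⟨ cong (rotate (suc n)) (lift₀-∘ g (ptFun s) _) ⟩
    rotate (suc n) (lift₀ g (ŝ (unrotate (suc n) p)))
      ≡⟨ cong (rotate (suc n) ∘ lift₀ g) (unrotate-rotate (suc n) _) ⟨
    rotate (suc n) (lift₀ g (unrotate (suc n) (rotate (suc n) (ŝ (unrotate (suc n) p)))))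
      ≡⟨ piBar-lift₀ g-injective _ ⟨
    piBarFun g (lift₀ g (rotate (suc n) (ŝ (unrotate (suc n) p))))
      ≡⟨ cong (piBarFun g ∘ lift₀ g) (ŝ-conj p) ⟨
    piBarFun g (lift₀ g (cycle₃ posJ posB posL (ŝ p)))
      ≡⟨ cong (piBarFun g) (cycle₃-conj (lift₀-injective g-injective) posJ posB posL (ŝ p)) ⟨
    piBarFun g (cycle₃ a b c (lift₀ g (ŝ p)))
      ≡⟨ cong (piBarFun g ∘ cycle₃ a b c) (lift₀-∘ g (ptFun s) p) ⟨
    piBarFun g (cycle₃ a b c (lift₀ g′ p))
      ∎
    where
    open ≡-Reasoning
    g′ = g ∘ ptFun s

  fixedPointsGained : ℕ
  fixedPointsGained = fixedAt σ′ b + fixedAt σ′ c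

  numCycles-∘ptFun : numCycles σ + 2 * fixedPointsGained ≤ numCycles σ′ + 2
  numCycles-∘ptFun = numCycles-∘cycle₃ (piBar-injective g-injective) a≢b a≢c b≢c piBar-∘ptFun

  numFixed-∘ptFun : numFixed σ′ + deltaFun (g ∘ ptFun s) ≤ numFixed σ + deltaFun g + fixedPointsGained
  numFixed-∘ptFun =
    fixed+delta-step (numFixed σ) (numFixed σ′) (deltaFun g) (deltaFun (g ∘ ptFun s)) (fixedAt σ a) (fixedAt σ b) (fixedAt σ c)
      (numFixed-except₃ a≢b a≢c b≢c
        (λ w w≢a w≢b w≢c → sym (trans (piBar-∘ptFun w) (cong σ (cycle₃-≢ a≢b a≢c b≢c w≢a w≢b w≢c)))))
      (deltaFun+fixedAt≡1 g-injective)
      (subst (λ t → deltaFun (g ∘ ptFun s) + fixedAt σ′ t ≡ 1) (trans (lift₀-∘ g (ptFun s) posB) (cong (lift₀ g) ŝ-posB))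
             (deltaFun+fixedAt≡1 g∘s-injective))

length-filter-allFin : ∀ {m} {P : Fin m → Set} (P? : Decidable P) → (∀ x → P x) → length (filter P? (allFin m)) ≡ m
length-filter-allFin {m} P? p = trans (cong length (filter-all P? {allFin m} (All.universal p _))) (length-tabulate id)

numCycles-≗id : ∀ {m} {σ : Fin m → Fin m} → (∀ w → σ w ≡ w) → numCycles σ ≡ m
numCycles-≗id {σ = σ} σ≗id = length-filter-allFin (orbitMin? σ)
  (λ x → isOrbitMin⇒orbitMin (λ { _ (k , refl) → ≤-reflexive (cong toℕ (sym (iter-fixed (σ≗id x) k))) }))

numFixed-≗id : ∀ {m} {σ : Fin m → Fin m} → (∀ w → σ w ≡ w) → numFixed σ ≡ m
numFixed-≗id {σ = σ} σ≗id = length-filter-allFin (λ x → σ x ≟ x) σ≗id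

piBar-≗id : ∀ {n} {g : Fin n → Fin n} → (∀ i → g i ≡ i) → ∀ w → piBarFun g w ≡ w
piBar-≗id {n} {g} g≗id w = begin
  piBarFun g w                              ≡⟨ cong (piBarFun g) (lift₀g≗id w) ⟨
  piBarFun g (lift₀ g w)                    ≡⟨ piBar-lift₀ (λ {x} {y} gx≡gy → trans (sym (g≗id x)) (trans gx≡gy (g≗id y))) w ⟩
  rotate n (lift₀ g (unrotate n w))         ≡⟨ cong (rotate n) (lift₀g≗id (unrotate n w)) ⟩
  rotate n (unrotate n w)                   ≡⟨ rotate-unrotate n w ⟩
  w                                         ∎
  where
  open ≡-Reasoning
  lift₀g≗id : ∀ p → lift₀ g p ≡ p
  lift₀g≗id Fin.zero    = refl
  lift₀g≗id (Fin.suc i) = cong Fin.suc (g≗id i)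

deltaFun-≗id : ∀ {n} {g : Fin n → Fin n} → (∀ i → g i ≡ i) → deltaFun g ≡ 0
deltaFun-≗id {zero}  g≗id = refl
deltaFun-≗id {suc n} {g} g≗id with g Fin.zero ≟ Fin.zero
... | yes _   = refl
... | no g0≢0 = contradiction (g≗id Fin.zero) g0≢0

¬PrefixTransposition0 : ¬ PrefixTransposition 0
¬PrefixTransposition0 (pt j l 1<j j<l l≤1) = <⇒≱ (<-trans 1<j j<l) l≤1

lower-bound : ∀ n (g : Fin n → Fin n) ss → (∀ i → composeAll g ss i ≡ i) →
  suc n + numCycles (piBarFun g) ≤ 2 * length ss + 2 * numFixed (piBarFun g) + 2 * deltaFun g
lower-bound n g [] g≗id = ≤-reflexive (begin
  suc n + numCycles (piBarFun g)       ≡⟨ cong (suc n +_) (numCycles-≗id (piBar-≗id g≗id)) ⟩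
  suc n + suc n                        ≡⟨ doubling (suc n) ⟩
  2 * 0 + 2 * suc n + 2 * 0            ≡⟨ cong₂ (λ x d → 2 * 0 + 2 * x + 2 * d) (numFixed-≗id (piBar-≗id g≗id)) (deltaFun-≗id g≗id) ⟨
  2 * 0 + 2 * numFixed (piBarFun g) + 2 * deltaFun g ∎)
  where
  open ≡-Reasoning
  doubling : ∀ x → x + x ≡ 2 * 0 + 2 * x + 2 * 0
  doubling = solve-∀
lower-bound zero    g (s ∷ ss) _ = contradiction s ¬PrefixTransposition0
lower-bound (suc n) g (s ∷ ss) sorted =
  sorting-step (suc n) (length ss) (numFixed (piBarFun g)) (numFixed (piBarFun g′)) (deltaFun g) (deltaFun g′)
    (numCycles-∘ptFun s g-injective g′-injective) (numFixed-∘ptFun s g-injective g′-injective)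
    (lower-bound (suc n) g′ ss sorted)
  where
  g′ = g ∘ ptFun s
  g-injective = sorted⇒injective (s ∷ ss) sorted
  g′-injective = sorted⇒injective ss sorted

theorem5 : ∀ (n : ℕ) (π : Permutation′ n) (ss : List (PrefixTransposition n)) →
    Sorts π ss →
    suc n + numCycles (piBar π) ≤ 2 * length ss + 2 * numFixed (piBar π) + 2 * delta π
theorem5 zero    π = lower-bound zero (π ⟨$⟩ʳ_)
theorem5 (suc n) π = lower-bound (suc n) (π ⟨$⟩ʳ_)
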